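{- Let $F=(W,\sim_1,\dots,\sim_n)$ be an equivalence frame. Then every instance of the schema $\left(\bigwedge_{i=1}^nS\varphi_i\right)\to SS\left(\bigwedge_{i=1}^n\varphi_i\right)$ (with each $\varphi_i$ an $i$-local formula of $\mathcal{L}_n$) is valid on $F$ if and only if $F$ is weakly directed.
   Context: $\mathcal{L}_n$: $\varphi::=p\mid\neg\varphi\mid\varphi\wedge\varphi\mid\Box_i\varphi$ ($i=1,\dots,n$), $\Diamond_i=\neg\Box_i\neg$, standard Kripke semantics; valid on a frame = true at all worlds under all valuations. $S\varphi:=\bigvee_{i=1}^n\Diamond_i\varphi$. A formula is $i$-local if it is a Boolean combination of formulae $\Box_i\psi$. An equivalence frame has all $\sim_i$ equivalence relations. $F$ is weakly directed if for all $w_0,w_1,\dots,w_n\in W$, whenever for each $i$ there is $j$ with $w_0\sim_jw_i$, there exists $w$ with $w_i\sim_iw$ for all $i=1,\dots,n$. -}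

module Defs where

open import Data.Nat using (ℕ; zero; suc)
open import Data.Fin using (Fin; zero; suc)
open import Data.Product using (Σ; ∃; _×_; _,_)
open import Data.Empty using (⊥)
open import Relation.Nullary using (¬_)
open import Relation.Binary.Structures using (IsEquivalence)

data Form (n : ℕ) : Set where
  var  : ℕ → Form n
  neg  : Form n → Form n
  _∧'_ : Form n → Form n → Form n
  box  : Fin n → Form n → Form n

infixr 6 _∧'_

module _ {n : ℕ} where
  _∨'_ : Form n → Form n → Form n
  φ ∨' ψ = neg (neg φ ∧' neg ψ)

  _⇒'_ : Form n → Form n → Form n
  φ ⇒' ψ = neg (φ ∧' neg ψ)

  dia : Fin n → Form n → Form n
  dia i φ = neg (box i (neg φ))

  ⊤' : Form n
  ⊤' = neg (var 0 ∧' neg (var 0))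

  ⊥' : Form n
  ⊥' = neg ⊤'

bigAnd : ∀ {n} k → (Fin k → Form n) → Form n
bigAnd zero          f = ⊤'
bigAnd (suc zero)    f = f zero
bigAnd (suc (suc k)) f = f zero ∧' bigAnd (suc k) (λ i → f (suc i))

bigOr : ∀ {n} k → (Fin k → Form n) → Form n
bigOr zero          f = ⊥'
bigOr (suc zero)    f = f zero
bigOr (suc (suc k)) f = f zero ∨' bigOr (suc k) (λ i → f (suc i))

S : ∀ {n} → Form n → Form n
S {n} φ = bigOr n (λ i → dia i φ)

data Local {n : ℕ} (i : Fin n) : Form n → Set where
  loc-box : ∀ ψ → Local i (box i ψ)
  loc-neg : ∀ {φ} → Local i φ → Local i (neg φ)
  loc-and : ∀ {φ ψ} → Local i φ → Local i ψ → Local i (φ ∧' ψ)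

record Frame (n : ℕ) : Set₁ where
  field
    W : Set
    R : Fin n → W → W → Set

open Frame public

EquivalenceFrame : ∀ {n} → Frame n → Set
EquivalenceFrame {n} F = (i : Fin n) → IsEquivalence (R F i)

Valuation : ∀ {n} → Frame n → Set₁
Valuation F = ℕ → W F → Set

sat : ∀ {n} (F : Frame n) → Valuation F → W F → Form n → Set
sat F V w (var p)   = V p w
sat F V w (neg φ)   = ¬ sat F V w φ
sat F V w (φ ∧' ψ)  = sat F V w φ × sat F V w ψ
sat F V w (box i φ) = ∀ v → R F i w v → sat F V v φ

ValidOn : ∀ {n} → Frame n → Form n → Set₁
ValidOn F φ = ∀ (V : Valuation F) (w : W F) → sat F V w φ

schema : ∀ {n} → (Fin n → Form n) → Form n
schema {n} φ = bigAnd n (λ i → S (φ i)) ⇒' S (S (bigAnd n φ))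

SchemaValid : ∀ {n} → Frame n → Set₁
SchemaValid {n} F =
  (φ : Fin n → Form n) → ((i : Fin n) → Local i (φ i)) → ValidOn F (schema φ)

WeaklyDirected : ∀ {n} → Frame n → Set
WeaklyDirected {n} F =
  (w₀ : W F) (ws : Fin n → W F) →
  ((i : Fin n) → ∃ λ j → R F j w₀ (ws i)) →
  ∃ λ w → (i : Fin n) → R F i (ws i) w

{-# OPTIONS --safe #-}
module Submission where

-- If F is weakly directed and w₀ ⊨ ⋀ᵢ S φᵢ, pick for each i a
-- world wᵢ seen from w₀ with wᵢ ⊨ φᵢ and join the wᵢ in a world w with
-- wᵢ ∼ᵢ w; an i-local formula is invariant along ∼ᵢ, so w ⊨ ⋀ᵢ φᵢ and
-- w₀ ∼ⱼ w₁ ∼₁ w witnesses S S ⋀ᵢ φᵢ. Conversely, given w₀ and the wᵢ, take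
-- φᵢ = □ᵢ pᵢ with pᵢ true exactly on the ∼ᵢ-class of wᵢ: the antecedent of
-- the schema holds at w₀, and any world reached by S S ⋀ᵢ φᵢ lies in every
-- such class, so it joins the wᵢ.

open import Defs
open import Level using (0ℓ)
open import Data.Nat using (ℕ; _≤_; z≤n; s≤s; zero; suc)
open import Data.Fin using (Fin; zero; suc; toℕ)
open import Data.Fin.Properties using (toℕ-injective)
open import Data.Product using (_×_; ∃; ∃₂; _,_; proj₁; proj₂)
open import Relation.Nullary using (¬_)
open import Relation.Binary.Definitions using (Reflexive)
open import Relation.Binary.PropositionalEquality using (_≡_; refl)
open import Relation.Binary.Structures using (IsEquivalence)
open import Axiom.ExcludedMiddle using (ExcludedMiddle)
open import Axiom.DoubleNegationElimination
  using (DoubleNegationElimination; em⇒dne)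

module Semantics {n : ℕ} (F : Frame n) (V : Valuation F) where

  _⊨_ : W F → Form n → Set
  w ⊨ φ = sat F V w φ

  sat-bigAnd⁺ : ∀ k (f : Fin k → Form n) {w} → (∀ i → w ⊨ f i) → w ⊨ bigAnd k f
  sat-bigAnd⁺ zero          f h = λ (p , ¬p) → ¬p p
  sat-bigAnd⁺ (suc zero)    f h = h zero
  sat-bigAnd⁺ (suc (suc k)) f h = h zero , sat-bigAnd⁺ (suc k) (λ i → f (suc i)) (λ i → h (suc i))

  sat-bigAnd⁻ : ∀ k (f : Fin k → Form n) {w} → w ⊨ bigAnd k f → ∀ i → w ⊨ f i
  sat-bigAnd⁻ (suc zero)    f s       zero    = s
  sat-bigAnd⁻ (suc (suc k)) f (s , _) zero    = s
  sat-bigAnd⁻ (suc (suc k)) f (_ , t) (suc i) = sat-bigAnd⁻ (suc k) (λ i → f (suc i)) t i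

  sat-bigOr⁺ : ∀ k (f : Fin k → Form n) {w} i → w ⊨ f i → w ⊨ bigOr k f
  sat-bigOr⁺ (suc zero)    f zero    s = s
  sat-bigOr⁺ (suc (suc k)) f zero    s = λ (¬s , _) → ¬s s
  sat-bigOr⁺ (suc (suc k)) f (suc i) s = λ (_ , ¬t) → ¬t (sat-bigOr⁺ (suc k) (λ i → f (suc i)) i s)

  sat-bigOr⁻ : ∀ k (f : Fin k → Form n) {w} → w ⊨ bigOr k f → ¬ ¬ ∃ λ i → w ⊨ f i
  sat-bigOr⁻ zero          f s ¬∃ = s (λ (p , ¬p) → ¬p p)
  sat-bigOr⁻ (suc zero)    f s ¬∃ = ¬∃ (zero , s)
  sat-bigOr⁻ (suc (suc k)) f s ¬∃ =
    s ( (λ s₀ → ¬∃ (zero , s₀))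
      , (λ t → sat-bigOr⁻ (suc k) (λ i → f (suc i)) t (λ (i , tᵢ) → ¬∃ (suc i , tᵢ))))

  sat-S⁺ : ∀ {i w v φ} → R F i w v → v ⊨ φ → w ⊨ S φ
  sat-S⁺ {i} {v = v} r s = sat-bigOr⁺ n _ i (λ ¬◇ → ¬◇ v r s)

  sat-S⁻ : ∀ {w φ} → w ⊨ S φ → ¬ ¬ ∃₂ λ i v → R F i w v × v ⊨ φ
  sat-S⁻ s ¬∃ = sat-bigOr⁻ n _ s (λ (i , ◇) → ◇ (λ v r t → ¬∃ (i , v , r , t)))

  local-sat-resp : EquivalenceFrame F → ∀ {i φ u v} → Local i φ → R F i u v → u ⊨ φ → v ⊨ φ
  local-sat-resp equiv {i} (loc-box _)   r s       = λ x r′ → s x (IsEquivalence.trans (equiv i) r r′)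
  local-sat-resp equiv {i} (loc-neg l)   r ¬s      = λ s → ¬s (local-sat-resp equiv l (IsEquivalence.sym (equiv i) r) s)
  local-sat-resp equiv     (loc-and l m) r (s , t) = local-sat-resp equiv l r s , local-sat-resp equiv m r t

weaklyDirected⇒schemaValid : ∀ {m} → DoubleNegationElimination 0ℓ →
  (F : Frame (suc m)) → EquivalenceFrame F → WeaklyDirected F → SchemaValid F
weaklyDirected⇒schemaValid {m} dne F equiv directed φ local V w₀ (premise , ¬conclusion) =
  ¬conclusion (conclusion (directed w₀ wᵢ seen))
  where
  open Semantics F V

  witness : ∀ i → ∃₂ λ j v → R F j w₀ v × v ⊨ φ i
  witness i = dne (sat-S⁻ (sat-bigAnd⁻ (suc m) _ premise i))

  wᵢ : Fin (suc m) → W F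
  wᵢ i = proj₁ (proj₂ (witness i))

  seen : ∀ i → ∃ λ j → R F j w₀ (wᵢ i)
  seen i = proj₁ (witness i) , proj₁ (proj₂ (proj₂ (witness i)))

  conclusion : (∃ λ w → ∀ i → R F i (wᵢ i) w) → w₀ ⊨ S (S (bigAnd (suc m) φ))
  conclusion (w , wᵢ∼w) =
    sat-S⁺ (proj₂ (seen zero)) (sat-S⁺ (wᵢ∼w zero) (sat-bigAnd⁺ (suc m) φ λ i →
      local-sat-resp equiv (local i) (wᵢ∼w i) (proj₂ (proj₂ (proj₂ (witness i))))))

schemaValid⇒weaklyDirected : ∀ {n} → DoubleNegationElimination 0ℓ →
  (F : Frame n) → (∀ i → Reflexive (R F i)) → SchemaValid F → WeaklyDirected F
schemaValid⇒weaklyDirected {n} dne F reflexive valid w₀ wᵢ seen =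
  dne λ ¬joined → valid φ (λ i → loc-box _) V w₀ (premise , λ ss → ¬joined (joined ss))
  where
  V : Valuation F
  V p w = ∃ λ i → toℕ i ≡ p × R F i (wᵢ i) w

  open Semantics F V

  φ : Fin n → Form n
  φ i = box i (var (toℕ i))

  premise : w₀ ⊨ bigAnd n (λ i → S (φ i))
  premise = sat-bigAnd⁺ n _ λ i → sat-S⁺ (proj₂ (seen i)) (λ v r → i , refl , r)

  φ⇒class : ∀ {w} i → w ⊨ φ i → R F i (wᵢ i) w
  φ⇒class {w} i s with s w (reflexive i)
  ... | _ , eq , r with toℕ-injective eq
  ...   | refl = r

  joined : w₀ ⊨ S (S (bigAnd n φ)) → ∃ λ w → ∀ i → R F i (wᵢ i) w
  joined ss with dne (sat-S⁻ ss)
  ... | _ , _ , _ , s with dne (sat-S⁻ s)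
  ...   | _ , w , _ , all = w , λ i → φ⇒class i (sat-bigAnd⁻ n φ all i)

lemma4p2 : ExcludedMiddle 0ℓ → (n : ℕ) → 1 ≤ n →
    (F : Frame n) → EquivalenceFrame F →
    (SchemaValid F → WeaklyDirected F) × (WeaklyDirected F → SchemaValid F)
lemma4p2 em (suc m) (s≤s z≤n) F equiv =
    schemaValid⇒weaklyDirected dne F (λ i → IsEquivalence.refl (equiv i))
  , weaklyDirected⇒schemaValid dne F equiv
  where
  dne : DoubleNegationElimination 0ℓ
  dne = em⇒dne em
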